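{- Let $(\Gamma,\tau)$ be a $z$-homogeneous triangulation of a connected closed surface and let $P$ be a special pair in $\Gamma$, with $z$-monodromy $M_P$ regarded as a permutation of $\{1,2,3,4\}$. Then the number of zigzags from $\tau$ passing through the edges of $P$ equals the number of cycles (fixed points counted as 1-cycles) of the permutation $sM_P$, where $s=(13)(24)$ and permutations are composed right to left.
   Context: Surfaces are connected closed 2-dimensional (not necessarily orientable). An embedded graph is a closed 2-cell embedding of a connected finite graph in a surface with no vertices of degree 2; a triangulation is such an embedding of a simple graph with all faces triangles. Two distinct edges are adjacent if they share a vertex and lie in a common face. A zigzag is a cyclic sequence of edges $\{e_i\}$ with $e_i,e_{i+1}$ adjacent, the faces containing $e_i,e_{i+1}$ and $e_{i+1},e_{i+2}$ distinct, and $e_i,e_{i+2}$ without common vertex; $Z^{ -1}$ denotes the reversed sequence. A $z$-orientation $\tau$ contains exactly one of $Z,Z^{ -1}$ for every zigzag $Z$. Each edge is traversed twice by zigzags of $\tau$: it is of type I if in opposite directions, of type II if in the same direction (then $\tau$ directs it). $(\Gamma,\tau)$ is $z$-homogeneous if every face has two edges of type I and one of type II, and every zigzag of $\tau$ is a cyclic sequence $\{e_i,e'_i,e''_i\}_{i=1}^n$ with $e_i$ of type II and $e'_i,e''_i$ of type I. A special pair $P$ is a directed path $e_1=v_1v_2$, $e_2=v_2v_3$ of two type II edges (directed by $\tau$). Let $F_i^\pm$ be the faces containing $e_i$, labelled so that $F_1^\delta,F_2^\delta$ are on the same side of $P$. Splitting $v_2$ into $v_2^\pm$ and $e_i$ into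 $e_i^\pm$ (directed as $e_i$, $e_1^\delta=v_1v_2^\delta$, $e_2^\delta=v_2^\delta v_3$, $e_i^\delta\subset F_i^\delta$) yields an embedded graph $N_P(\Gamma)$ with a new 4-gonal face $F_P$. For a face $F$ with consecutive vertices $x_1,\dots,x_k$ let $\Omega(F)$ be its $2k$ directed edges and $D_F$ the permutation of $\Omega(F)$ sending $xx'$ to $x'x''$ for consecutive vertices $x,x',x''$ of $F$. The $z$-monodromy $M_F$ of $F$: for $e\in\Omega(F)$ take $e_0$ with $D_F(e_0)=e$ and the zigzag containing $e_0,e$ consecutively; $M_F(e)$ is the first element of $\Omega(F)$ occurring in this zigzag after $e$. The $z$-monodromy $M_P$ of $P$ is the restriction of $M_{F_P}$ (in $N_P(\Gamma)$) to $\omega(F_P)=\{e_1^+,e_2^+,e_1^-,e_2^-\}$; it is a permutation of this set, and we write $1,2,3,4$ for $e_1^+,e_2^+,e_1^-,e_2^-$. -}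

module Defs where

open import Data.Nat using (ℕ; zero; suc; _≤_; _<_)
open import Data.Fin using (Fin; #_) renaming (_≟_ to _≟ᶠ_)
open import Data.Vec using (Vec; []; _∷_; lookup)
open import Data.Bool using (Bool; true; false; not; if_then_else_)
open import Data.Sum using (_⊎_; inj₁; inj₂)
open import Data.Product using (Σ; _×_; ∃; ∃-syntax)
open import Data.Unit using (⊤)
open import Data.Empty using (⊥)
open import Relation.Nullary using (¬_; does)
open import Relation.Binary.PropositionalEquality using (_≡_; _≢_)
open import Function.Bundles using (_⇔_)

iter : {A : Set} → (A → A) → ℕ → A → A
iter f zero    x = x
iter f (suc k) x = f (iter f k x)

Order : {A : Set} → (A → A) → A → ℕ → Set
Order g x k = (1 ≤ k) × (iter g k x ≡ x) × (∀ j → 1 ≤ j → j < k → iter g j x ≢ x)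

data Orbit₂ {A : Set} (g h : A → A) (x : A) : A → Set where
  here : Orbit₂ g h x x
  byG  : ∀ {y} → Orbit₂ g h x y → Orbit₂ g h x (g y)
  byH  : ∀ {y} → Orbit₂ g h x y → Orbit₂ g h x (h y)

data Orbit₃ {A : Set} (f g h : A → A) (x : A) : A → Set where
  here : Orbit₃ f g h x x
  byF  : ∀ {y} → Orbit₃ f g h x y → Orbit₃ f g h x (f y)
  byG  : ∀ {y} → Orbit₃ f g h x y → Orbit₃ f g h x (g y)
  byH  : ∀ {y} → Orbit₃ f g h x y → Orbit₃ f g h x (h y)

-- "the list xs (indexed by Fin k) meets exactly m classes of the relation R":
-- a surjective labelling of the k entries by m labels such that two entries
-- get the same label iff they are R-related.
NumClasses : {A : Set} {k : ℕ} → (A → A → Set) → (Fin k → A) → ℕ → Set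
NumClasses {k = k} R xs m =
  Σ (Fin k → Fin m) λ c →
    (∀ (j : Fin m) → ∃[ i ] c i ≡ j) ×
    (∀ i i' → (c i ≡ c i') ⇔ R (xs i) (xs i'))

SameCycle : {A : Set} → (A → A) → A → A → Set
SameCycle π x y = ∃[ k ] iter π k x ≡ y

NumCycles : {k : ℕ} → (Fin k → Fin k) → ℕ → Set
NumCycles π m = NumClasses (SameCycle π) (λ i → i) m

-- Embedded graphs (maps) on closed surfaces, encoded by flags.
-- A flag is an incident triple (vertex, edge, face); σ₀ changes the
-- vertex, σ₁ the edge, σ₂ the face, keeping the other two entries.

record Map : Set where
  field
    n   : ℕ
    σ₀ σ₁ σ₂ : Fin n → Fin n
    inv₀ : ∀ x → σ₀ (σ₀ x) ≡ x
    inv₁ : ∀ x → σ₁ (σ₁ x) ≡ x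
    inv₂ : ∀ x → σ₂ (σ₂ x) ≡ x
    fpf₀ : ∀ x → σ₀ x ≢ x
    fpf₁ : ∀ x → σ₁ x ≢ x
    fpf₂ : ∀ x → σ₂ x ≢ x
    comm₀₂ : ∀ x → σ₀ (σ₂ x) ≡ σ₂ (σ₀ x)
    fpf₀₂  : ∀ x → σ₀ (σ₂ x) ≢ x
    connected : ∀ x y → Orbit₃ σ₀ σ₁ σ₂ x y

module _ (Γ : Map) where
  open Map Γ

  SameV SameE SameF : Fin n → Fin n → Set
  SameV = Orbit₂ σ₁ σ₂
  SameE = Orbit₂ σ₀ σ₂
  SameF = Orbit₂ σ₀ σ₁

  VertexDegree : Fin n → ℕ → Set
  VertexDegree x d = Order (λ y → σ₂ (σ₁ y)) x d

  FaceSize : Fin n → ℕ → Set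
  FaceSize x k = Order (λ y → σ₁ (σ₀ y)) x k

  -- triangulation: simple graph (no loops, no multiple edges), all faces
  -- triangles, no vertices of degree 2 (closedness of the 2-cell embedding
  -- follows from simplicity + triangular faces)
  IsTriangulation : Set
  IsTriangulation =
    (∀ x → ¬ SameV x (σ₀ x)) ×
    (∀ x y → SameV x y → SameV (σ₀ x) (σ₀ y) → SameE x y) ×
    (∀ x → FaceSize x 3) ×
    (∀ x → ¬ VertexDegree x 2)

  -- The flag x represents the traversal of the
  -- edge of x starting at the vertex of x; the ρ-orbits are exactly the
  -- zigzags (as cyclic sequences of directed edges), and the reversed
  -- zigzag Z⁻¹ of the orbit of x is the orbit of σ₀ (σ₂ x).
  ρ : Fin n → Fin n
  ρ x = σ₁ (σ₀ (σ₂ x))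

  SameZigzag : Fin n → Fin n → Set
  SameZigzag = SameCycle ρ

  -- z-orientation: a set of zigzags (ρ-invariant set of flags) containing
  -- exactly one of Z, Z⁻¹ for every zigzag Z
  IsZOrientation : (Fin n → Bool) → Set
  IsZOrientation τ = (∀ x → τ (ρ x) ≡ τ x) × (∀ x → τ (σ₀ (σ₂ x)) ≡ not (τ x))

  module _ (τ : Fin n → Bool) where
    -- the edge of x is of type II: the two τ-traversals of it (flags with
    -- τ = true among the four flags of the edge) start at the same vertex;
    -- otherwise (¬ TypeII) it is of type I.
    TypeII : Fin n → Set
    TypeII x = τ x ≡ τ (σ₂ x)

    ExactlyOne : Set → Set → Set → Set
    ExactlyOne A B C = (A × ¬ B × ¬ C) ⊎ (¬ A × B × ¬ C) ⊎ (¬ A × ¬ B × C)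

    -- z-homogeneous: each (triangular) face, with edges those of x, σ₁ x,
    -- σ₁ (σ₀ x), has exactly one edge of type II; and every zigzag of τ
    -- is of the form {eᵢ, eᵢ', eᵢ''} with eᵢ of type II, eᵢ', eᵢ'' of type I.
    IsZHomogeneous : Set
    IsZHomogeneous =
      (∀ x → ExactlyOne (TypeII x) (TypeII (σ₁ x)) (TypeII (σ₁ (σ₀ x)))) ×
      (∀ x → τ x ≡ true → TypeII x ⊎ TypeII (ρ x) ⊎ TypeII (ρ (ρ x))) ×
      (∀ x → τ x ≡ true → TypeII x →
         ¬ TypeII (ρ x) × ¬ TypeII (ρ (ρ x)) × TypeII (ρ (ρ (ρ x))))

    -- Special pair given by τ-flags a (edge e₁ = v₁v₂ directed by τ from
    -- vertex(a) = v₁ to vertex(σ₀ a) = v₂) and b (edge e₂ = v₂v₃ from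
    -- vertex(b) = v₂), both of type II.
    IsSpecialPair : Fin n → Fin n → Set
    IsSpecialPair a b =
      (τ a ≡ true) × TypeII a × (τ b ≡ true) × TypeII b × SameV (σ₀ a) b

  -- Labelling of sides: F₁⁺ := face of a, F₂⁺ := face of b.  They are on
  -- the same side of P iff, turning around v₂ starting from σ₀ a (at v₂,
  -- on e₁, in F₁⁺) and alternately changing edge (σ₁) and face (σ₂), one
  -- reaches b by a change of edge, i.e. arriving at e₂ from within F₂⁺
  -- through the sector bounded by e₁ and e₂ that contains F₁⁺.
  SameSide : Fin n → Fin n → Set
  SameSide a b = ∃[ k ] σ₁ (iter (λ y → σ₂ (σ₁ y)) k (σ₀ a)) ≡ b

  -- The embedded graph N_P(Γ): flags of Γ plus eight new flags of the
  -- new 4-gonal face F_P, numbered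
  --   0 = (v₁ ,e₁⁺,F_P)  1 = (v₂⁺,e₁⁺,F_P)  2 = (v₁ ,e₁⁻,F_P)  3 = (v₂⁻,e₁⁻,F_P)
  --   4 = (v₂⁺,e₂⁺,F_P)  5 = (v₃ ,e₂⁺,F_P)  6 = (v₂⁻,e₂⁻,F_P)  7 = (v₃ ,e₂⁻,F_P)
  -- The old flags a, σ₀a (in F₁⁺) become flags of e₁⁺, σ₂a, σ₀σ₂a of e₁⁻,
  -- b, σ₀b of e₂⁺ and σ₂b, σ₀σ₂b of e₂⁻.

  module NP (a b : Fin n) where
    Flag : Set
    Flag = Fin n ⊎ Fin 8

    _==_ : Fin n → Fin n → Bool
    x == y = does (x ≟ᶠ y)

    old : Fin 8 → Fin n
    old k = lookup (a ∷ σ₀ a ∷ σ₂ a ∷ σ₀ (σ₂ a) ∷ b ∷ σ₀ b ∷ σ₂ b ∷ σ₀ (σ₂ b) ∷ []) k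

    σ₀' σ₁' σ₂' : Flag → Flag
    σ₀' (inj₁ x) = inj₁ (σ₀ x)
    σ₀' (inj₂ k) = inj₂ (lookup (# 1 ∷ # 0 ∷ # 3 ∷ # 2 ∷ # 5 ∷ # 4 ∷ # 7 ∷ # 6 ∷ []) k)
    σ₁' (inj₁ x) = inj₁ (σ₁ x)
    σ₁' (inj₂ k) = inj₂ (lookup (# 2 ∷ # 4 ∷ # 0 ∷ # 6 ∷ # 1 ∷ # 7 ∷ # 3 ∷ # 5 ∷ []) k)
    σ₂' (inj₁ x) =
      if x == old (# 0) then inj₂ (# 0) else
      if x == old (# 1) then inj₂ (# 1) else
      if x == old (# 2) then inj₂ (# 2) else
      if x == old (# 3) then inj₂ (# 3) else
      if x == old (# 4) then inj₂ (# 4) else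
      if x == old (# 5) then inj₂ (# 5) else
      if x == old (# 6) then inj₂ (# 6) else
      if x == old (# 7) then inj₂ (# 7) else
      inj₁ (σ₂ x)
    σ₂' (inj₂ k) = inj₁ (old k)

    ρ' : Flag → Flag
    ρ' x = σ₁' (σ₀' (σ₂' x))

    IsNew : Flag → Set
    IsNew (inj₁ _) = ⊥
    IsNew (inj₂ _) = ⊤

    EdgeOnFP : Flag → Set
    EdgeOnFP g = IsNew g ⊎ IsNew (σ₂' g)

    -- ω(F_P) = e₁⁺, e₂⁺, e₁⁻, e₂⁻ (numbered 1,2,3,4 ↦ Fin 4 = 0,1,2,3),
    -- a directed edge x→x' of F_P being the flag (x, edge, F_P).
    ω : Fin 4 → Flag
    ω i = inj₂ (lookup (# 0 ∷ # 4 ∷ # 2 ∷ # 6 ∷ []) i)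

    -- z-monodromy of F_P restricted to ω(F_P): the zigzag through e₀, e
    -- (D_F e₀ = e) is the ρ'-orbit of the F_P-flag of e itself; M(e) is the
    -- directed edge of F_P traversed at the first later step.
    MonodromyP : Fin 4 → Fin 4 → Set
    MonodromyP i j =
      ∃[ k ] (1 ≤ k) ×
        (∀ l → 1 ≤ l → l < k → ¬ EdgeOnFP (iter ρ' l (ω i))) ×
        ((iter ρ' k (ω i) ≡ ω j) ⊎ (σ₂' (iter ρ' k (ω i)) ≡ ω j))

swapS : Fin 4 → Fin 4
swapS i = lookup (# 2 ∷ # 3 ∷ # 0 ∷ # 1 ∷ []) i

{-# OPTIONS --safe #-}
module Submission where

-- The zigzag of N_P(Γ) leaving the new face F_P along ω(i) enters Γ as the
-- continuation of the zigzag of Γ through the τ-flag of the same edge of P on the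
-- other side, t (s i), and follows it until that zigzag next traverses e₁ or e₂
-- in the τ-direction, where it re-enters F_P.  Hence M_P s is the first-return map
-- of the zigzag dynamics ρ to the four τ-flags t of e₁, e₂, s M_P is its conjugate
-- by s, and the cycles of a first-return map are the traces of the ρ-orbits on
-- those flags.
-- Only simplicity (v₁ ≠ v₂) and the z-orientation are needed; z-homogeneity and
-- the side convention play no role.

open import Defs
open import Data.Fin using (Fin; zero; suc; toℕ; #_) renaming (_≟_ to _≟ᶠ_)
open import Data.Fin.Properties using (pigeonhole; any?)
open import Data.Bool using (Bool; true; false; not; if_then_else_)
open import Data.Vec using ([]; _∷_; lookup)
open import Data.Product using (Σ-syntax; _×_; _,_; proj₁; proj₂; ∃-syntax)
open import Data.Sum using (inj₁; inj₂)
open import Data.Empty using (⊥-elim)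
open import Data.Nat using (ℕ; zero; suc; _+_; _∸_; _≤_; _<_; z≤n; s≤s; _≤?_)
open import Data.Nat.Properties
  using (≤-refl; <⇒≤; ≰⇒>; n<1+n; +-suc; +-identityʳ; m≤n⇒m<n∨m≡n;
         m<n⇒0<n∸m; m+[n∸m]≡n; m∸n+n≡m; ∸-monoʳ-<)
open import Data.Nat.Induction using (<-wellFounded)
open import Induction.WellFounded using (Acc; acc)
open import Relation.Nullary using (¬_; Dec; yes; no; does)
open import Relation.Nullary.Decidable using (dec-true; dec-false)
open import Relation.Binary.PropositionalEquality
open import Function.Base using (_∘_)
open import Function.Definitions using (Injective)
open import Function.Bundles using (_⇔_; mk⇔)
open import Function.Construct.Composition using (_⇔-∘_)
open import Function.Construct.Symmetry using (⇔-sym)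

iter-+ : {A : Set} (f : A → A) (m k : ℕ) (x : A) →
         iter f (m + k) x ≡ iter f m (iter f k x)
iter-+ f zero    k x = refl
iter-+ f (suc m) k x = cong f (iter-+ f m k x)

iter-sucʳ : {A : Set} (f : A → A) (k : ℕ) (x : A) → iter f (suc k) x ≡ iter f k (f x)
iter-sucʳ f zero    x = refl
iter-sucʳ f (suc k) x = cong f (iter-sucʳ f k x)

iter-injective : {A : Set} {f : A → A} → Injective _≡_ _≡_ f →
                 ∀ k → Injective _≡_ _≡_ (iter f k)
iter-injective f-inj zero    e = e
iter-injective f-inj (suc k) e = iter-injective f-inj k (f-inj e)

iter-invariant : {A B : Set} {f : A → A} (g : A → B) → (∀ x → g (f x) ≡ g x) →
                 ∀ k x → g (iter f k x) ≡ g x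
iter-invariant g inv zero    x = refl
iter-invariant g inv (suc k) x = trans (inv _) (iter-invariant g inv k x)

iter-split : {A : Set} (f : A → A) {m k : ℕ} {x : A} → m ≤ k →
             iter f k x ≡ iter f (k ∸ m) (iter f m x)
iter-split f {m} {k} {x} m≤k =
  trans (cong (λ q → iter f q x) (sym (m∸n+n≡m m≤k))) (iter-+ f (k ∸ m) m x)

involutive⇒injective : {A : Set} (g : A → A) → (∀ x → g (g x) ≡ x) → Injective _≡_ _≡_ g
involutive⇒injective g inv {x} {y} e = trans (sym (inv x)) (trans (cong g e) (inv y))

iter-conjugate : {A : Set} (s : A → A) → (∀ x → s (s x) ≡ x) → (f : A → A) →
                 ∀ k x → iter (s ∘ f ∘ s) k x ≡ s (iter f k (s x))
iter-conjugate s inv f zero    x = sym (inv x)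
iter-conjugate s inv f (suc k) x =
  cong (λ y → s (f y)) (trans (cong s (iter-conjugate s inv f k x)) (inv _))

SameCycle-conjugate : {A : Set} (s : A → A) → (∀ x → s (s x) ≡ x) → (f : A → A) →
                      ∀ x y → SameCycle (s ∘ f ∘ s) x y ⇔ SameCycle f (s x) (s y)
SameCycle-conjugate s inv f x y = mk⇔
  (λ (k , e) → k , trans (sym (inv _)) (cong s (trans (sym (iter-conjugate s inv f k x)) e)))
  (λ (k , e) → k , trans (iter-conjugate s inv f k x) (trans (cong s e) (inv y)))

SameCycle-step : {A : Set} (f : A → A) {x y : A} → SameCycle f (f x) y → SameCycle f x y
SameCycle-step f {x} (k , e) = suc k , trans (iter-sucʳ f k x) e

-- By pigeonhole two of the iterates 0, …, N of x coincide; injectivity cancels the smaller.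
iter-returns : ∀ {N} {f : Fin N → Fin N} → Injective _≡_ _≡_ f →
               ∀ x → ∃[ p ] (1 ≤ p × iter f p x ≡ x)
iter-returns {N} {f} f-inj x
  with i , j , i<j , e ← pigeonhole (n<1+n N) (λ (i : Fin (suc N)) → iter f (toℕ i) x) =
  toℕ j ∸ toℕ i , m<n⇒0<n∸m i<j ,
  sym (iter-injective f-inj (toℕ i) (begin
    iter f (toℕ i) x                           ≡⟨ e ⟩
    iter f (toℕ j) x                           ≡⟨ cong (λ q → iter f q x) (sym (m+[n∸m]≡n (<⇒≤ i<j))) ⟩
    iter f (toℕ i + (toℕ j ∸ toℕ i)) x         ≡⟨ iter-+ f (toℕ i) _ x ⟩
    iter f (toℕ i) (iter f (toℕ j ∸ toℕ i) x)  ∎))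
  where open ≡-Reasoning

least-witness : {P : ℕ → Set} → (∀ l → Dec (P l)) →
                ∀ {n} → P n → ∃[ h ] (P h × (∀ l → l < h → ¬ P l))
least-witness {P} P? {n} pn = scan n 0 (λ _ ()) (subst P (sym (+-identityʳ n)) pn)
  where
    scan : ∀ d k → (∀ l → l < k → ¬ P l) → P (d + k) →
           ∃[ h ] (P h × (∀ l → l < h → ¬ P l))
    scan d k below p with P? k
    ... | yes pk = k , pk , below
    scan zero    k below p | no ¬pk = ⊥-elim (¬pk p)
    scan (suc d) k below p | no ¬pk = scan d (suc k) below′ (subst P (sym (+-suc d k)) p)
      where
        below′ : ∀ l → l < suc k → ¬ P l
        below′ l (s≤s l≤k) with m≤n⇒m<n∨m≡n l≤k
        ... | inj₁ l<k  = below l l<k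
        ... | inj₂ refl = ¬pk

skip : {N : ℕ} {A : Set} {x y : Fin N} {u v : A} → x ≢ y →
       (if does (x ≟ᶠ y) then u else v) ≡ v
skip {x = x} {y} x≢y rewrite dec-false (x ≟ᶠ y) x≢y = refl

stop : {N : ℕ} {A : Set} (x : Fin N) {u v : A} → (if does (x ≟ᶠ x) then u else v) ≡ u
stop x rewrite dec-true (x ≟ᶠ x) refl = refl

module FirstReturn {N k : ℕ} (f : Fin N → Fin N) (f-injective : Injective _≡_ _≡_ f)
                   (t : Fin k → Fin N) (t-injective : Injective _≡_ _≡_ t) where

  InImage : Fin N → Set
  InImage x = ∃[ j ] x ≡ t j

  record Return (i : Fin k) : Set where
    field
      time   : ℕ
      1≤time : 1 ≤ time
      target : Fin k
      lands  : iter f time (t i) ≡ t target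
      avoids : ∀ l → 1 ≤ l → l < time → ¬ InImage (iter f l (t i))

  firstReturn : ∀ i → Return i
  firstReturn i with iter-returns f-injective (t i)
  ... | suc p , _ , back
      with h , (j , e) , below ←
             least-witness (λ l → any? (λ j → iter f (suc l) (t i) ≟ᶠ t j)) {p} (i , back) =
    record { time = suc h ; 1≤time = s≤s z≤n ; target = j ; lands = e
           ; avoids = λ { (suc l) _ (s≤s l<h) → below l l<h } }

  module Ret (i : Fin k) = Return (firstReturn i)

  returnMap : Fin k → Fin k
  returnMap = Ret.target

  returns-by : ∀ i {K} → 1 ≤ K → InImage (iter f K (t i)) → Ret.time i ≤ K
  returns-by i {K} 1≤K hit with Ret.time i ≤? K
  ... | yes time≤K = time≤K
  ... | no  time≰K = ⊥-elim (Ret.avoids i K 1≤K (≰⇒> time≰K) hit)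

  sameCycle⇔ : ∀ i j → SameCycle f (t i) (t j) ⇔ SameCycle returnMap i j
  sameCycle⇔ i j =
    mk⇔ (λ (K , e) → fromOrbit K (<-wellFounded K) i e) (λ (k , e) → toOrbit k i e)
    where
      fromOrbit : ∀ K → Acc _<_ K → ∀ i → iter f K (t i) ≡ t j → SameCycle returnMap i j
      fromOrbit zero _ i e = 0 , t-injective e
      fromOrbit K@(suc _) (acc rec) i e =
        SameCycle-step returnMap
          (fromOrbit (K ∸ Ret.time i) (rec (∸-monoʳ-< (Ret.1≤time i) time≤K))
                     (returnMap i) resumed)
        where
          time≤K : Ret.time i ≤ K
          time≤K = returns-by i (s≤s z≤n) (j , e)
          resumed : iter f (K ∸ Ret.time i) (t (returnMap i)) ≡ t j
          resumed = trans (cong (iter f (K ∸ Ret.time i)) (sym (Ret.lands i)))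
                          (trans (sym (iter-split f time≤K)) e)

      toOrbit : ∀ k i → iter returnMap k i ≡ j → SameCycle f (t i) (t j)
      toOrbit zero i e = 0 , cong t e
      toOrbit (suc k) i e
        with K , e′ ← toOrbit k (returnMap i) (trans (sym (iter-sucʳ returnMap k i)) e) =
        K + Ret.time i ,
        trans (iter-+ f K (Ret.time i) (t i)) (trans (cong (iter f K) (Ret.lands i)) e′)

NumClasses-pullback : {A B : Set} {k m : ℕ} (R : A → A → Set) (S : B → B → Set)
                      (xs : Fin k → A) (ys : Fin k → B) (ψ φ : Fin k → Fin k) →
                      (∀ i → ψ (φ i) ≡ i) →
                      (∀ i i' → S (ys i) (ys i') ⇔ R (xs (ψ i)) (xs (ψ i'))) →
                      NumClasses R xs m → NumClasses S ys m
NumClasses-pullback R S xs ys ψ φ ψφ S⇔R (c , onto , c⇔R) =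
  c ∘ ψ ,
  (λ j → let (i , ci≡j) = onto j in φ i , trans (cong c (ψφ i)) ci≡j) ,
  (λ i i' → ⇔-sym (S⇔R i i') ⇔-∘ c⇔R (ψ i) (ψ i'))

NumClasses-reindex : {A B : Set} {k m : ℕ} (R : A → A → Set) (S : B → B → Set)
                     (xs : Fin k → A) (ys : Fin k → B) (ψ φ : Fin k → Fin k) →
                     (∀ i → ψ (φ i) ≡ i) → (∀ i → φ (ψ i) ≡ i) →
                     (∀ i i' → S (ys i) (ys i') ⇔ R (xs (ψ i)) (xs (ψ i'))) →
                     NumClasses R xs m ⇔ NumClasses S ys m
NumClasses-reindex R S xs ys ψ φ ψφ φψ S⇔R = mk⇔
  (NumClasses-pullback R S xs ys ψ φ ψφ S⇔R)
  (NumClasses-pullback S R ys xs φ ψ φψ R⇔S)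
  where
    R⇔S : ∀ i i' → R (xs i) (xs i') ⇔ S (ys (φ i)) (ys (φ i'))
    R⇔S i i' = ⇔-sym (subst₂ (λ u v → S (ys (φ i)) (ys (φ i')) ⇔ R (xs u) (xs v))
                              (ψφ i) (ψφ i') (S⇔R (φ i) (φ i')))

swapS-involutive : ∀ i → swapS (swapS i) ≡ i
swapS-involutive zero                   = refl
swapS-involutive (suc zero)             = refl
swapS-involutive (suc (suc zero))       = refl
swapS-involutive (suc (suc (suc zero))) = refl

ρ-injective : (Γ : Map) → Injective _≡_ _≡_ (ρ Γ)
ρ-injective Γ =
  involutive⇒injective σ₂ inv₂ ∘ involutive⇒injective σ₀ inv₀ ∘ involutive⇒injective σ₁ inv₁
  where open Map Γ

module SpecialPair (Γ : Map) (τ : Fin (Map.n Γ) → Bool)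
  (loopless : ∀ x → ¬ SameV Γ x (Map.σ₀ Γ x)) (zo : IsZOrientation Γ τ)
  (a b : Fin (Map.n Γ))
  (τa : τ a ≡ true) (IIa : TypeII Γ τ a) (τb : τ b ≡ true) (IIb : TypeII Γ τ b)
  (v₂ : SameV Γ (Map.σ₀ Γ a) b) where
  open Map Γ
  open NP Γ a b

  τσ₂a : τ (σ₂ a) ≡ true
  τσ₂a = trans (sym IIa) τa

  τσ₂b : τ (σ₂ b) ≡ true
  τσ₂b = trans (sym IIb) τb

  τ-σ₀σ₂ : ∀ {x} → τ x ≡ true → τ (σ₀ (σ₂ x)) ≡ false
  τ-σ₀σ₂ {x} τx = trans (proj₂ zo x) (cong not τx)

  τ-σ₀ : ∀ {x} → τ (σ₂ x) ≡ true → τ (σ₀ x) ≡ false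
  τ-σ₀ {x} τσ₂x = subst (λ y → τ (σ₀ y) ≡ false) (inv₂ x) (τ-σ₀σ₂ τσ₂x)

  τ-separates : ∀ {x y} → τ x ≡ true → τ y ≡ false → x ≢ y
  τ-separates τx τy refl with () ← trans (sym τx) τy

  τ-orbit : ∀ l {x} → τ x ≡ true → τ (iter (ρ Γ) l x) ≡ true
  τ-orbit l {x} τx = trans (iter-invariant τ (proj₁ zo) l x) τx

  off-v₁ : ∀ {x} → SameV Γ (σ₀ a) x → x ≢ a
  off-v₁ p refl = loopless (σ₀ a) (subst (SameV Γ (σ₀ a)) (sym (inv₀ a)) p)

  b≢a : b ≢ a
  b≢a = off-v₁ v₂

  σ₂b≢a : σ₂ b ≢ a
  σ₂b≢a = off-v₁ (byH v₂)

  b≢σ₂a : b ≢ σ₂ a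
  b≢σ₂a e = σ₂b≢a (trans (cong σ₂ e) (inv₂ a))

  σ₂b≢σ₂a : σ₂ b ≢ σ₂ a
  σ₂b≢σ₂a = b≢a ∘ involutive⇒injective σ₂ inv₂

  -- The τ-flags of e₁ and e₂, ordered like ω (e₁⁺, e₂⁺, e₁⁻, e₂⁻).
  t : Fin 4 → Fin n
  t i = lookup (a ∷ b ∷ σ₂ a ∷ σ₂ b ∷ []) i

  τt : ∀ j → τ (t j) ≡ true
  τt zero                   = τa
  τt (suc zero)             = τb
  τt (suc (suc zero))       = τσ₂a
  τt (suc (suc (suc zero))) = τσ₂b

  t-injective : Injective _≡_ _≡_ t
  t-injective {zero}                 {zero}                 _ = refl
  t-injective {suc zero}             {suc zero}             _ = refl
  t-injective {suc (suc zero)}       {suc (suc zero)}       _ = refl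
  t-injective {suc (suc (suc zero))} {suc (suc (suc zero))} _ = refl
  t-injective {zero}                 {suc zero}             e = ⊥-elim (b≢a (sym e))
  t-injective {zero}                 {suc (suc zero)}       e = ⊥-elim (fpf₂ a (sym e))
  t-injective {zero}                 {suc (suc (suc zero))} e = ⊥-elim (σ₂b≢a (sym e))
  t-injective {suc zero}             {zero}                 e = ⊥-elim (b≢a e)
  t-injective {suc zero}             {suc (suc zero)}       e = ⊥-elim (b≢σ₂a e)
  t-injective {suc zero}             {suc (suc (suc zero))} e = ⊥-elim (fpf₂ b (sym e))
  t-injective {suc (suc zero)}       {zero}                 e = ⊥-elim (fpf₂ a e)
  t-injective {suc (suc zero)}       {suc zero}             e = ⊥-elim (b≢σ₂a (sym e))
  t-injective {suc (suc zero)}       {suc (suc (suc zero))} e = ⊥-elim (σ₂b≢σ₂a (sym e))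
  t-injective {suc (suc (suc zero))} {zero}                 e = ⊥-elim (σ₂b≢a e)
  t-injective {suc (suc (suc zero))} {suc zero}             e = ⊥-elim (fpf₂ b e)
  t-injective {suc (suc (suc zero))} {suc (suc zero)}       e = ⊥-elim (σ₂b≢σ₂a e)

  open FirstReturn (ρ Γ) (ρ-injective Γ) t t-injective

  -- σ₂' tests its argument against the old flags a, σ₀ a, σ₂ a, σ₀ (σ₂ a), b, … in
  -- turn; the four σ₀-flags among them are τ-false, so a τ-flag never matches them.
  σ₂'-outside : ∀ {x} → τ x ≡ true → ¬ InImage x → σ₂' (inj₁ x) ≡ inj₁ (σ₂ x)
  σ₂'-outside {x} τx x∉ =
    trans (skip (x≢t zero)) (
    trans (skip (x≢τfalse (τ-σ₀ τσ₂a))) (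
    trans (skip (x≢t (suc (suc zero)))) (
    trans (skip (x≢τfalse (τ-σ₀σ₂ τa))) (
    trans (skip (x≢t (suc zero))) (
    trans (skip (x≢τfalse (τ-σ₀ τσ₂b))) (
    trans (skip (x≢t (suc (suc (suc zero))))) (
    skip (x≢τfalse (τ-σ₀σ₂ τb)))))))))
    where
      x≢t : ∀ j → x ≢ t j
      x≢t j e = x∉ (j , e)
      x≢τfalse : ∀ {y} → τ y ≡ false → x ≢ y
      x≢τfalse = τ-separates τx

  σ₂'-t : ∀ j → σ₂' (inj₁ (t j)) ≡ ω j
  σ₂'-t zero = stop a
  σ₂'-t (suc zero) =
    trans (skip b≢a) (
    trans (skip (τ-separates τb (τ-σ₀ τσ₂a))) (
    trans (skip b≢σ₂a) (
    trans (skip (τ-separates τb (τ-σ₀σ₂ τa))) (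
    stop b))))
  σ₂'-t (suc (suc zero)) =
    trans (skip (fpf₂ a)) (
    trans (skip (τ-separates τσ₂a (τ-σ₀ τσ₂a))) (
    stop (σ₂ a)))
  σ₂'-t (suc (suc (suc zero))) =
    trans (skip σ₂b≢a) (
    trans (skip (τ-separates τσ₂b (τ-σ₀ τσ₂a))) (
    trans (skip σ₂b≢σ₂a) (
    trans (skip (τ-separates τσ₂b (τ-σ₀σ₂ τa))) (
    trans (skip (fpf₂ b)) (
    trans (skip (τ-separates τσ₂b (τ-σ₀ τσ₂b))) (
    stop (σ₂ b)))))))

  ρ'-outside : ∀ {x} → τ x ≡ true → ¬ InImage x → ρ' (inj₁ x) ≡ inj₁ (ρ Γ x)
  ρ'-outside τx x∉ = cong (σ₁' ∘ σ₀') (σ₂'-outside τx x∉)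

  ¬EdgeOnFP-outside : ∀ {x} → τ x ≡ true → ¬ InImage x → ¬ EdgeOnFP (inj₁ x)
  ¬EdgeOnFP-outside τx x∉ (inj₂ new) = subst IsNew (σ₂'-outside τx x∉) new

  ρ'-ω : ∀ i → ρ' (ω i) ≡ inj₁ (ρ Γ (t (swapS i)))
  ρ'-ω zero                   = cong (inj₁ ∘ σ₁ ∘ σ₀) (sym (inv₂ a))
  ρ'-ω (suc zero)             = cong (inj₁ ∘ σ₁ ∘ σ₀) (sym (inv₂ b))
  ρ'-ω (suc (suc zero))       = refl
  ρ'-ω (suc (suc (suc zero))) = refl

  follows : ∀ i l → 1 ≤ l → l ≤ Ret.time (swapS i) →
            iter ρ' l (ω i) ≡ inj₁ (iter (ρ Γ) l (t (swapS i)))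
  follows i (suc zero)    _ _        = ρ'-ω i
  follows i (suc (suc l)) _ l<time =
    trans (cong ρ' (follows i (suc l) (s≤s z≤n) (<⇒≤ l<time)))
          (ρ'-outside (τ-orbit (suc l) (τt (swapS i)))
                      (Ret.avoids (swapS i) (suc l) (s≤s z≤n) l<time))

  M : Fin 4 → Fin 4
  M i = returnMap (swapS i)

  monodromy : ∀ i → MonodromyP i (M i)
  monodromy i = time , 1≤time , off-FP , inj₂ enters
    where
      open Ret (swapS i)
      open ≡-Reasoning
      off-FP : ∀ l → 1 ≤ l → l < time → ¬ EdgeOnFP (iter ρ' l (ω i))
      off-FP l 1≤l l<time rewrite follows i l 1≤l (<⇒≤ l<time) =
        ¬EdgeOnFP-outside (τ-orbit l (τt (swapS i))) (avoids l 1≤l l<time)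
      enters : σ₂' (iter ρ' time (ω i)) ≡ ω (M i)
      enters = begin
        σ₂' (iter ρ' time (ω i))                  ≡⟨ cong σ₂' (follows i time 1≤time ≤-refl) ⟩
        σ₂' (inj₁ (iter (ρ Γ) time (t (swapS i)))) ≡⟨ cong (σ₂' ∘ inj₁) lands ⟩
        σ₂' (inj₁ (t target))                     ≡⟨ σ₂'-t target ⟩
        ω target                                  ∎

  z : Fin 4 → Fin n
  z i = lookup (a ∷ σ₂ a ∷ b ∷ σ₂ b ∷ []) i

  ψ φ : Fin 4 → Fin 4
  ψ i = lookup (# 1 ∷ # 3 ∷ # 0 ∷ # 2 ∷ []) i
  φ i = lookup (# 2 ∷ # 0 ∷ # 3 ∷ # 1 ∷ []) i

  ψφ : ∀ i → ψ (φ i) ≡ i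
  ψφ zero                   = refl
  ψφ (suc zero)             = refl
  ψφ (suc (suc zero))       = refl
  ψφ (suc (suc (suc zero))) = refl

  φψ : ∀ i → φ (ψ i) ≡ i
  φψ zero                   = refl
  φψ (suc zero)             = refl
  φψ (suc (suc zero))       = refl
  φψ (suc (suc (suc zero))) = refl

  t∘swapS≡z∘ψ : ∀ i → t (swapS i) ≡ z (ψ i)
  t∘swapS≡z∘ψ zero                   = refl
  t∘swapS≡z∘ψ (suc zero)             = refl
  t∘swapS≡z∘ψ (suc (suc zero))       = refl
  t∘swapS≡z∘ψ (suc (suc (suc zero))) = refl

  sM : Fin 4 → Fin 4
  sM i = swapS (M i)

  cycles⇔zigzags : ∀ i i' → SameCycle sM i i' ⇔ SameZigzag Γ (z (ψ i)) (z (ψ i'))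
  cycles⇔zigzags i i' =
    subst₂ (λ u v → SameCycle sM i i' ⇔ SameZigzag Γ u v) (t∘swapS≡z∘ψ i) (t∘swapS≡z∘ψ i')
      (⇔-sym (sameCycle⇔ (swapS i) (swapS i'))
        ⇔-∘ SameCycle-conjugate swapS swapS-involutive returnMap i i')

  zigzag-count : ∀ m → NumClasses (SameZigzag Γ) z m ⇔ NumCycles sM m
  zigzag-count m =
    NumClasses-reindex (SameZigzag Γ) (SameCycle sM) z (λ i → i) ψ φ ψφ φψ cycles⇔zigzags

lemma2 : (Γ : Map) (τ : Fin (Map.n Γ) → Bool) →
           IsTriangulation Γ → IsZOrientation Γ τ → IsZHomogeneous Γ τ →
           (a b : Fin (Map.n Γ)) → IsSpecialPair Γ τ a b → SameSide Γ a b →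
           Σ[ M ∈ (Fin 4 → Fin 4) ]
             ((∀ i → NP.MonodromyP Γ a b i (M i)) ×
              (∀ m → NumClasses (SameZigzag Γ)
                                (λ i → lookup (a ∷ Map.σ₂ Γ a ∷ b ∷ Map.σ₂ Γ b ∷ []) i) m
                     ⇔ NumCycles (λ i → swapS (M i)) m))
lemma2 Γ τ (loopless , _) zo _ a b (τa , IIa , τb , IIb , v₂) _ = M , monodromy , zigzag-count
  where open SpecialPair Γ τ loopless zo a b τa IIa τb IIb v₂
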